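{- Let $n,m,d\in\mathbb{Z}^+$ with $n,m,d\geq 2$, and let $T_{m,d}$ be the complete $m$-ary tree of height $d$. Then \[ \chi_n(T_{m,d})=\begin{cases} 2, & \text{if } n\geq 4 \text{ or } n \nmid (m+1) \text{ or } d=2,\\ 3, & \text{otherwise}. \end{cases}\]
   Context: $T_{m,d}$ is the rooted tree in which every vertex at distance less than $d$ from the root has exactly $m$ children and all leaves are at distance $d$ from the root. For a graph $G=(V,E)$, a $\mathbb{Z}$-labeling is a map $\ell:V\to\mathbb{Z}$; its order is the size of its range; it is proper if adjacent vertices get different labels. $N[v]$ is the closed neighborhood of $v$. A closed coloring with nonzero remainders mod $n$ is a labeling with $\sum_{w\in N[v]}\ell(w)\not\equiv 0 \pmod n$ for all $v\in V$. $\chi_n(G)$ denotes the minimum order of a proper closed coloring with nonzero remainders mod $n$ of $G$. -}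

module Defs where

open import Data.Nat as ℕ using (ℕ; suc; _≤_; _<_; _<?_; s≤s)
open import Data.Nat.Properties using (<⇒≤)
open import Data.Integer as ℤ using (ℤ; +_)
open import Data.Integer.Divisibility as ℤD using ()
open import Data.Fin using (Fin)
open import Data.List using (List; []; _∷_; length; map; foldr; allFin)
open import Data.List.Relation.Unary.Unique.Propositional using (Unique)
open import Data.List.Membership.Propositional using (_∈_)
open import Data.Product using (Σ; ∃; _×_; _,_; proj₁)
open import Relation.Binary.PropositionalEquality using (_≡_; _≢_)
open import Relation.Nullary using (¬_; yes; no)

-- Vertices of the complete m-ary tree T_{m,d} of height d:
-- a vertex is the path from the root, stored as a list of child indices
-- with the most recent step at the head (so the children of w are c ∷ w,
-- the root is []), of length at most d.
Vtx : ℕ → ℕ → Set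
Vtx m d = Σ (List (Fin m)) (λ w → length w ≤ d)

Labeling : ℕ → ℕ → Set
Labeling m d = Vtx m d → ℤ

Proper : ∀ {m d} → Labeling m d → Set
Proper {m} {d} ℓ = ∀ (c : Fin m) (w : List (Fin m))
  (p : length w ≤ d) (q : length (c ∷ w) ≤ d) → ℓ (w , p) ≢ ℓ (c ∷ w , q)

parentTerm : ∀ {m d} → Labeling m d → Vtx m d → ℤ
parentTerm ℓ ([] , p) = + 0
parentTerm ℓ (c ∷ w , p) = ℓ (w , <⇒≤ p)

childTerm : ∀ {m d} → Labeling m d → Vtx m d → ℤ
childTerm {m} {d} ℓ (w , p) with length w <? d
... | yes q = foldr ℤ._+_ (+ 0) (map (λ c → ℓ (c ∷ w , q)) (allFin m))
... | no _ = + 0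

closedSum : ∀ {m d} → Labeling m d → Vtx m d → ℤ
closedSum ℓ v = ℓ v ℤ.+ parentTerm ℓ v ℤ.+ childTerm ℓ v

ClosedNonzeroMod : ℕ → ∀ {m d} → Labeling m d → Set
ClosedNonzeroMod n ℓ = ∀ v → ¬ ((+ n) ℤD.∣ closedSum ℓ v)

HasOrder : ∀ {m d} → Labeling m d → ℕ → Set
HasOrder {m} {d} ℓ k = Σ (List ℤ) λ L →
  Unique L × length L ≡ k × (∀ v → ℓ v ∈ L) × (∀ x → x ∈ L → ∃ λ (v : Vtx m d) → ℓ v ≡ x)

ChiIs : ℕ → ℕ → ℕ → ℕ → Set
ChiIs n m d k =
  (Σ (Labeling m d) λ ℓ → Proper ℓ × ClosedNonzeroMod n ℓ × HasOrder ℓ k)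
  × (∀ (ℓ : Labeling m d) j → Proper ℓ → ClosedNonzeroMod n ℓ → HasOrder ℓ j → k ≤ j)

{-# OPTIONS --safe #-}
-- Label every vertex by a function f of its depth. Since m ≡ -1 (mod n) when n ∣ m + 1, the
-- closed sum is f 0 - f 1 at the root, f k + f (k - 1) - f (k + 1) at an inner vertex of depth k
-- and f d + f (d - 1) at a leaf, modulo n. Alternating labels a, b thus leave the residues a - b,
-- b, a + b and, if d ≥ 3, a; the labels 1, 2 make them nonzero for n ≥ 4 and 0, 1 for d = 2, while
-- for n ∤ m + 1 the labels 1, 0 give the closed sums 1 and m + 1. Conversely a proper labeling with
-- two values alternates with the depth, and for n ≤ 3 one of a, b, a - b, a + b is ≡ 0 (mod n),
-- because every residue is 0 or ±1. Three labels repeating with period 3 along the depth do work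
-- whenever n ∣ 6.
module Submission where

open import Defs
open import Data.Nat using (ℕ; zero; suc; _≤_; _<_; _+_; z≤n; s≤s; _<?_; >-nonZero)
import Data.Nat.Properties as ℕₚ
open import Data.Nat.Divisibility using (_∣_; _∣?_; divides; >⇒∤)
open import Data.Nat.Coprimality using (Coprime; coprime?)
import Data.Integer as ℤ
open ℤ using (ℤ; +_)
import Data.Integer.Properties as ℤₚ
import Data.Integer.Divisibility as Unsigned
import Data.Integer.Divisibility.Signed as Signed
open import Data.Integer.DivMod using (_%_; _/_; n%d<d; a≡a%n+[a/n]*n)
open import Data.Integer.Tactic.RingSolver using (solve-∀)
open import Data.Fin using (zero)
open import Data.List using (List; []; _∷_; length; map; foldr; allFin; replicate)
import Data.List.Properties as Listₚ
open import Data.List.Membership.Propositional using (_∈_)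
open import Data.List.Relation.Unary.Any using (here; there)
open import Data.List.Relation.Unary.All using ([]; _∷_)
open import Data.List.Relation.Unary.AllPairs using ([]; _∷_)
open import Data.List.Relation.Unary.Unique.Propositional using (Unique)
open import Data.Product using (Σ; ∃; ∃₂; _×_; _,_; proj₁)
open import Data.Sum using (_⊎_; inj₁; inj₂; [_,_]′; swap)
open import Function using (_∘_; id)
open import Relation.Binary.PropositionalEquality
  using (_≡_; _≢_; refl; sym; trans; cong; cong₂; subst; ≢-sym)
open import Relation.Nullary using (¬_; Dec; yes; no; contradiction)
open import Relation.Nullary.Decidable using (True; toWitness; decidable-stable)

NonzeroMod : ℕ → ℤ → Set
NonzeroMod n s = ¬ (+ n Unsigned.∣ s)

nonzeroMod-small : ∀ {n s} → 0 < ℤ.∣ s ∣ → ℤ.∣ s ∣ < n → NonzeroMod n s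
nonzeroMod-small 0<∣s∣ ∣s∣<n = >⇒∤ {{>-nonZero 0<∣s∣}} ∣s∣<n

nonzeroMod-coprime : ∀ {n k s} → 2 ≤ n → n ∣ k → Coprime ℤ.∣ s ∣ k → NonzeroMod n s
nonzeroMod-coprime 2≤n n∣k coprime n∣s = ℕₚ.<⇒≢ 2≤n (sym (coprime (n∣s , n∣k)))

module _ {n m : ℕ} (n∣m+1 : n ∣ m + 1) where

  private
    regroup : ∀ s u M → s ℤ.+ M ℤ.* u ≡ (s ℤ.- u) ℤ.+ u ℤ.* (M ℤ.+ + 1)
    regroup = solve-∀

    n∣u[m+1] : ∀ u → + n Signed.∣ u ℤ.* (+ m ℤ.+ + 1)
    n∣u[m+1] u = Signed.∣n⇒∣m*n u (Signed.∣ᵤ⇒∣ n∣m+1)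

  nonzeroMod[s-u]⇒nonzeroMod[s+m*u] : ∀ s u → NonzeroMod n (s ℤ.- u) → NonzeroMod n (s ℤ.+ + m ℤ.* u)
  nonzeroMod[s-u]⇒nonzeroMod[s+m*u] s u nz n∣s+m*u = nz (Signed.∣⇒∣ᵤ n∣s-u)
    where
    n∣s-u : + n Signed.∣ s ℤ.- u
    n∣s-u = Signed.∣m+n∣n⇒∣m {m = s ℤ.- u}
      (subst (+ n Signed.∣_) (regroup s u (+ m)) (Signed.∣ᵤ⇒∣ n∣s+m*u)) (n∣u[m+1] u)

  nonzeroMod[s+m*u]⇒nonzeroMod[s-u] : ∀ s u → NonzeroMod n (s ℤ.+ + m ℤ.* u) → NonzeroMod n (s ℤ.- u)
  nonzeroMod[s+m*u]⇒nonzeroMod[s-u] s u nz n∣s-u = nz (Signed.∣⇒∣ᵤ n∣s+m*u)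
    where
    n∣s+m*u : + n Signed.∣ s ℤ.+ + m ℤ.* u
    n∣s+m*u = subst (+ n Signed.∣_) (sym (regroup s u (+ m)))
      (Signed.∣m∣n⇒∣m+n {m = s ℤ.- u} (Signed.∣ᵤ⇒∣ n∣s-u) (n∣u[m+1] u))

∣x⊎∣x-1⊎∣x+1 : ∀ {n} → 1 ≤ n → n ≤ 3 → ∀ x →
  + n Signed.∣ x ⊎ + n Signed.∣ x ℤ.- + 1 ⊎ + n Signed.∣ x ℤ.+ + 1
∣x⊎∣x-1⊎∣x+1 {n@(suc _)} _ n≤3 x = residue (x % + n) (n%d<d x (+ n)) (a≡a%n+[a/n]*n x (+ n))
  where
  q = x / + n
  residue : ∀ r → r < n → x ≡ + r ℤ.+ q ℤ.* + n →
    + n Signed.∣ x ⊎ + n Signed.∣ x ℤ.- + 1 ⊎ + n Signed.∣ x ℤ.+ + 1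
  residue 0 _ x≡ = inj₁ (Signed.divides q (trans x≡ (ℤₚ.+-identityˡ _)))
  residue 1 _ x≡ = inj₂ (inj₁ (Signed.divides q (trans (cong (ℤ._- + 1) x≡) (1-1 q (+ n)))))
    where
    1-1 : ∀ q N → + 1 ℤ.+ q ℤ.* N ℤ.- + 1 ≡ q ℤ.* N
    1-1 = solve-∀
  residue 2 2<n x≡ =
    inj₂ (inj₂ (subst (+ n Signed.∣_) (sym x+1≡) (Signed.∣m∣n⇒∣m+n n∣3 (Signed.∣n⇒∣m*n q Signed.∣-refl))))
    where
    2+1 : ∀ q N → + 2 ℤ.+ q ℤ.* N ℤ.+ + 1 ≡ + 3 ℤ.+ q ℤ.* N
    2+1 = solve-∀
    x+1≡ : x ℤ.+ + 1 ≡ + 3 ℤ.+ q ℤ.* + n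
    x+1≡ = trans (cong (ℤ._+ + 1) x≡) (2+1 q (+ n))
    n∣3 : + n Signed.∣ + 3
    n∣3 = subst (λ k → + n Signed.∣ + k) (ℕₚ.≤-antisym n≤3 2<n) Signed.∣-refl
  residue (suc (suc (suc _))) r<n _ with ℕₚ.<-≤-trans r<n n≤3
  ... | s≤s (s≤s (s≤s ()))

∣x⊎∣y⊎∣x-y⊎∣x+y : ∀ {n} → 1 ≤ n → n ≤ 3 → ∀ x y →
  + n Signed.∣ x ⊎ + n Signed.∣ y ⊎ + n Signed.∣ x ℤ.- y ⊎ + n Signed.∣ x ℤ.+ y
∣x⊎∣y⊎∣x-y⊎∣x+y {n} 1≤n n≤3 x y = combine (∣x⊎∣x-1⊎∣x+1 1≤n n≤3 x) (∣x⊎∣x-1⊎∣x+1 1≤n n≤3 y)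
  where
  n∣ = + n Signed.∣_
  x-y : ∀ {x′ y′} → n∣ x′ → n∣ y′ → x′ ℤ.- y′ ≡ x ℤ.- y → n∣ (x ℤ.- y)
  x-y n∣x′ n∣y′ eq = subst n∣ eq (Signed.∣m∣n⇒∣m-n n∣x′ n∣y′)
  x+y : ∀ {x′ y′} → n∣ x′ → n∣ y′ → x′ ℤ.+ y′ ≡ x ℤ.+ y → n∣ (x ℤ.+ y)
  x+y n∣x′ n∣y′ eq = subst n∣ eq (Signed.∣m∣n⇒∣m+n n∣x′ n∣y′)
  minus-minus : ∀ x y → (x ℤ.- + 1) ℤ.- (y ℤ.- + 1) ≡ x ℤ.- y
  minus-minus = solve-∀
  plus-plus : ∀ x y → (x ℤ.+ + 1) ℤ.- (y ℤ.+ + 1) ≡ x ℤ.- y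
  plus-plus = solve-∀
  minus-plus : ∀ x y → (x ℤ.- + 1) ℤ.+ (y ℤ.+ + 1) ≡ x ℤ.+ y
  minus-plus = solve-∀
  plus-minus : ∀ x y → (x ℤ.+ + 1) ℤ.+ (y ℤ.- + 1) ≡ x ℤ.+ y
  plus-minus = solve-∀
  combine : n∣ x ⊎ n∣ (x ℤ.- + 1) ⊎ n∣ (x ℤ.+ + 1) → n∣ y ⊎ n∣ (y ℤ.- + 1) ⊎ n∣ (y ℤ.+ + 1) →
    n∣ x ⊎ n∣ y ⊎ n∣ (x ℤ.- y) ⊎ n∣ (x ℤ.+ y)
  combine (inj₁ n∣x) _ = inj₁ n∣x
  combine (inj₂ _) (inj₁ n∣y) = inj₂ (inj₁ n∣y)
  combine (inj₂ (inj₁ n∣x-1)) (inj₂ (inj₁ n∣y-1)) = (inj₂ ∘ inj₂ ∘ inj₁) (x-y n∣x-1 n∣y-1 (minus-minus x y))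
  combine (inj₂ (inj₂ n∣x+1)) (inj₂ (inj₂ n∣y+1)) = (inj₂ ∘ inj₂ ∘ inj₁) (x-y n∣x+1 n∣y+1 (plus-plus x y))
  combine (inj₂ (inj₁ n∣x-1)) (inj₂ (inj₂ n∣y+1)) = (inj₂ ∘ inj₂ ∘ inj₂) (x+y n∣x-1 n∣y+1 (minus-plus x y))
  combine (inj₂ (inj₂ n∣x+1)) (inj₂ (inj₁ n∣y-1)) = (inj₂ ∘ inj₂ ∘ inj₂) (x+y n∣x+1 n∣y-1 (plus-minus x y))

alternate : ℤ → ℤ → ℕ → ℤ
alternate a b zero = a
alternate a b (suc k) = alternate b a k

alternate-pairs : ∀ (P : ℤ → ℤ → Set) {a b} → P a b → P b a →
  ∀ k → P (alternate a b k) (alternate a b (suc k))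
alternate-pairs P pab pba zero = pab
alternate-pairs P pab pba (suc k) = alternate-pairs P pba pab k

cycle3 : ℤ → ℤ → ℤ → ℕ → ℤ
cycle3 x y z zero = x
cycle3 x y z (suc k) = cycle3 y z x k

cycle3-triples : ∀ (P : ℤ → ℤ → ℤ → Set) {x y z} → P x y z → P y z x → P z x y →
  ∀ k → P (cycle3 x y z k) (cycle3 x y z (suc k)) (cycle3 x y z (suc (suc k)))
cycle3-triples P pxyz pyzx pzxy zero = pxyz
cycle3-triples P pxyz pyzx pzxy (suc k) = cycle3-triples P pyzx pzxy pxyz k

depthLabeling : ∀ {m d} → (ℕ → ℤ) → Labeling m d
depthLabeling f (w , _) = f (length w)

depthLabeling-proper : ∀ {m d} {f : ℕ → ℤ} → (∀ k → f k ≢ f (suc k)) → Proper (depthLabeling {m} {d} f)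
depthLabeling-proper f≢ _ w _ _ = f≢ (length w)

vertexAtDepth : ∀ {m d} k → k ≤ d → Vtx (suc m) d
vertexAtDepth k k≤d = replicate k zero , subst (_≤ _) (sym (Listₚ.length-replicate k)) k≤d

depthLabeling-hasOrder : ∀ {m d} (f : ℕ → ℤ) (L : List ℤ) → Unique L → (∀ k → f k ∈ L) →
  (∀ {x} → x ∈ L → ∃ λ k → k ≤ d × f k ≡ x) → HasOrder (depthLabeling {suc m} {d} f) (length L)
depthLabeling-hasOrder f L unique f∈L onto = L , unique , refl , (f∈L ∘ length ∘ proj₁) , attained
  where
  attained : ∀ x → x ∈ L → ∃ λ v → depthLabeling f v ≡ x
  attained x x∈L with onto x∈L
  ... | k , k≤d , fk≡x = vertexAtDepth k k≤d , trans (cong f (Listₚ.length-replicate k)) fk≡x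

sum-const : ∀ {A : Set} {g : A → ℤ} {k} → (∀ x → g x ≡ k) →
  ∀ xs → foldr ℤ._+_ (+ 0) (map g xs) ≡ + length xs ℤ.* k
sum-const g≡k [] = refl
sum-const {k = k} g≡k (x ∷ xs) =
  trans (cong₂ ℤ._+_ (g≡k x) (sum-const g≡k xs)) (sym (ℤₚ.suc-* (+ length xs) k))

childTerm-const : ∀ {m d} (ℓ : Labeling m d) {w p k} (q : length w < d) →
  (∀ c q → ℓ (c ∷ w , q) ≡ k) → childTerm ℓ (w , p) ≡ + m ℤ.* k
childTerm-const {m} {d} ℓ {w} {k = k} q ℓ≡k with length w <? d
... | yes q′ = trans (sum-const (λ c → ℓ≡k c q′) (allFin m))
                     (cong (λ j → + j ℤ.* k) (Listₚ.length-tabulate {n = m} id))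
... | no ¬q = contradiction q ¬q

childTerm-leaf : ∀ {m d} (ℓ : Labeling m d) {w p} → ¬ (length w < d) → childTerm ℓ (w , p) ≡ + 0
childTerm-leaf {d = d} ℓ {w} ¬q with length w <? d
... | yes q = contradiction q ¬q
... | no _ = refl

closedSum-root : ∀ {m d} (f : ℕ → ℤ) p →
  closedSum (depthLabeling {m} {suc d} f) ([] , p) ≡ f 0 ℤ.+ + m ℤ.* f 1
closedSum-root {m} {d} f p = cong₂ ℤ._+_ (ℤₚ.+-identityʳ (f 0))
  (childTerm-const (depthLabeling {m} {suc d} f) {[]} {p} (s≤s z≤n) (λ _ _ → refl))

closedSum-inner : ∀ {m d} (f : ℕ → ℤ) c w p → suc (length w) < d →
  closedSum (depthLabeling {m} {d} f) (c ∷ w , p)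
    ≡ f (suc (length w)) ℤ.+ f (length w) ℤ.+ + m ℤ.* f (suc (suc (length w)))
closedSum-inner {m} {d} f c w p q = cong (λ t → f (suc (length w)) ℤ.+ f (length w) ℤ.+ t)
  (childTerm-const (depthLabeling {m} {d} f) {c ∷ w} {p} q (λ _ _ → refl))

closedSum-leaf : ∀ {m d} (f : ℕ → ℤ) c w p → length w ≡ d →
  closedSum (depthLabeling {m} {suc d} f) (c ∷ w , p) ≡ f (suc d) ℤ.+ f d
closedSum-leaf {m} {d} f c w p refl =
  trans (cong (λ t → f (suc d) ℤ.+ f d ℤ.+ t) no-children) (ℤₚ.+-identityʳ _)
  where
  no-children : childTerm (depthLabeling {m} {suc d} f) (c ∷ w , p) ≡ + 0
  no-children = childTerm-leaf (depthLabeling f) {c ∷ w} {p} (ℕₚ.<-irrefl refl)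

depthLabeling-closedNonzero : ∀ {n m d} (f : ℕ → ℤ) →
  NonzeroMod n (f 0 ℤ.+ + m ℤ.* f 1) →
  (∀ k → suc k < suc d → NonzeroMod n (f (suc k) ℤ.+ f k ℤ.+ + m ℤ.* f (suc (suc k)))) →
  NonzeroMod n (f (suc d) ℤ.+ f d) →
  ClosedNonzeroMod n (depthLabeling {m} {suc d} f)
depthLabeling-closedNonzero {n} {m} {d} f root inner leaf ([] , p) =
  subst (NonzeroMod n) (sym (closedSum-root {m} f p)) root
depthLabeling-closedNonzero {n} {m} {d} f root inner leaf (c ∷ w , p) with ℕₚ.m≤n⇒m<n∨m≡n p
... | inj₁ q = subst (NonzeroMod n) (sym (closedSum-inner {m} f c w p q)) (inner (length w) q)
... | inj₂ at-leaves =
  subst (NonzeroMod n) (sym (closedSum-leaf {m} f c w p (ℕₚ.suc-injective at-leaves))) leaf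

closedSum-cong : ∀ {m d} {ℓ ℓ′ : Labeling m d} → (∀ v → ℓ v ≡ ℓ′ v) →
  ∀ v → closedSum ℓ v ≡ closedSum ℓ′ v
closedSum-cong {m} {d} {ℓ} {ℓ′} ℓ≗ℓ′ v =
  cong₂ ℤ._+_ (cong₂ ℤ._+_ (ℓ≗ℓ′ v) (parentTerm-cong v)) (childTerm-cong v)
  where
  parentTerm-cong : ∀ v → parentTerm ℓ v ≡ parentTerm ℓ′ v
  parentTerm-cong ([] , _) = refl
  parentTerm-cong (_ ∷ _ , _) = ℓ≗ℓ′ _
  childTerm-cong : ∀ v → childTerm ℓ v ≡ childTerm ℓ′ v
  childTerm-cong (w , _) with length w <? d
  ... | yes q = cong (foldr ℤ._+_ (+ 0)) (Listₚ.map-cong (λ c → ℓ≗ℓ′ (c ∷ w , q)) (allFin m))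
  ... | no _ = refl

closedNonzero-cong : ∀ {n m d} {ℓ ℓ′ : Labeling m d} → (∀ v → ℓ v ≡ ℓ′ v) →
  ClosedNonzeroMod n ℓ → ClosedNonzeroMod n ℓ′
closedNonzero-cong {n} ℓ≗ℓ′ nz v = subst (NonzeroMod n) (closedSum-cong ℓ≗ℓ′ v) (nz v)

order2⇒twoValued : ∀ {m d} {ℓ : Labeling m d} → HasOrder ℓ 2 → ∃₂ λ a b → ∀ v → ℓ v ≡ a ⊎ ℓ v ≡ b
order2⇒twoValued ([] , _ , () , _)
order2⇒twoValued (_ ∷ [] , _ , () , _)
order2⇒twoValued (_ ∷ _ ∷ _ ∷ _ , _ , () , _)
order2⇒twoValued (a ∷ b ∷ [] , _ , _ , ℓ∈L , _) = a , b , ∈-pair ∘ ℓ∈L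
  where
  ∈-pair : ∀ {x} → x ∈ a ∷ b ∷ [] → x ≡ a ⊎ x ≡ b
  ∈-pair (here x≡a) = inj₁ x≡a
  ∈-pair (there (here x≡b)) = inj₂ x≡b
  ∈-pair (there (there ()))

proper-twoValued⇒alternating : ∀ {m d} {ℓ : Labeling m d} {a b} → Proper ℓ →
  (∀ v → ℓ v ≡ a ⊎ ℓ v ≡ b) → ℓ ([] , z≤n) ≡ a → ∀ v → ℓ v ≡ alternate a b (length (proj₁ v))
proper-twoValued⇒alternating {ℓ = ℓ} {a} {b} proper twoValued root≡a (w , p) = alternating w p
  where
  other : ∀ k z → z ≡ a ⊎ z ≡ b → z ≢ alternate a b k → z ≡ alternate a b (suc k)
  other = alternate-pairs (λ s t → ∀ z → z ≡ a ⊎ z ≡ b → z ≢ s → z ≡ t)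
    (λ { _ (inj₁ z≡a) z≢a → contradiction z≡a z≢a ; _ (inj₂ z≡b) _ → z≡b })
    (λ { _ (inj₁ z≡a) _ → z≡a ; _ (inj₂ z≡b) z≢b → contradiction z≡b z≢b })
  alternating : ∀ w p → ℓ (w , p) ≡ alternate a b (length w)
  alternating [] z≤n = root≡a
  alternating (c ∷ w) p = other (length w) _ (twoValued (c ∷ w , p))
    (λ eq → proper c w (ℕₚ.<⇒≤ p) p (trans (alternating w (ℕₚ.<⇒≤ p)) (sym eq)))

proper-order2⇒alternating : ∀ {m d} {ℓ : Labeling m d} → Proper ℓ → HasOrder ℓ 2 →
  ∃₂ λ a b → ∀ v → ℓ v ≡ alternate a b (length (proj₁ v))
proper-order2⇒alternating proper order with order2⇒twoValued order
... | a , b , twoValued with twoValued ([] , z≤n)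
...   | inj₁ root≡a = a , b , proper-twoValued⇒alternating proper twoValued root≡a
...   | inj₂ root≡b = b , a , proper-twoValued⇒alternating proper (swap ∘ twoValued) root≡b

distinct∈⇒2≤length : ∀ {A : Set} {x y : A} {L : List A} → x ≢ y → x ∈ L → y ∈ L → 2 ≤ length L
distinct∈⇒2≤length {L = _ ∷ _ ∷ _} _ _ _ = s≤s (s≤s z≤n)
distinct∈⇒2≤length {L = _ ∷ []} x≢y (here refl) (here refl) = contradiction refl x≢y

proper⇒2≤order : ∀ {m d} {ℓ : Labeling (suc m) (suc d)} {j} → Proper ℓ → HasOrder ℓ j → 2 ≤ j
proper⇒2≤order proper (_ , _ , refl , ℓ∈L , _) =
  distinct∈⇒2≤length (proper zero [] z≤n (s≤s z≤n)) (ℓ∈L _) (ℓ∈L _)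

alternating-¬closedNonzero : ∀ {n m d a b} → 1 ≤ n → n ≤ 3 → n ∣ suc m + 1 →
  ¬ ClosedNonzeroMod n (depthLabeling {suc m} {suc (suc (suc d))} (alternate a b))
alternating-¬closedNonzero {n} {m} {d} {a} {b} 1≤n n≤3 n∣m+1 nz =
  [ nz-a ∘ Signed.∣⇒∣ᵤ , [ nz-b ∘ Signed.∣⇒∣ᵤ , [ nz-a-b ∘ Signed.∣⇒∣ᵤ , nz-a+b ∘ Signed.∣⇒∣ᵤ ]′ ]′ ]′
    (∣x⊎∣y⊎∣x-y⊎∣x+y 1≤n n≤3 a b)
  where
  f : ℕ → ℤ
  f = alternate a b
  at : ∀ v {s} → closedSum (depthLabeling f) v ≡ s → NonzeroMod n s
  at v closedSum≡s = subst (NonzeroMod n) closedSum≡s (nz v)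
  reduce : ∀ s u → NonzeroMod n (s ℤ.+ + suc m ℤ.* u) → NonzeroMod n (s ℤ.- u)
  reduce = nonzeroMod[s+m*u]⇒nonzeroMod[s-u] n∣m+1
  cancel : ∀ x y → x ℤ.+ y ℤ.- y ≡ x
  cancel = solve-∀
  1≤3+d : 1 ≤ suc (suc (suc d))
  1≤3+d = s≤s z≤n
  2≤3+d : 2 ≤ suc (suc (suc d))
  2≤3+d = s≤s (s≤s z≤n)
  3≤3+d : 3 ≤ suc (suc (suc d))
  3≤3+d = s≤s (s≤s (s≤s z≤n))
  nz-a-b : NonzeroMod n (a ℤ.- b)
  nz-a-b = reduce a b (at ([] , z≤n) (closedSum-root {suc m} {suc (suc d)} f z≤n))
  nz-b : NonzeroMod n b
  nz-b = subst (NonzeroMod n) (cancel b a)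
    (reduce (b ℤ.+ a) a (at (zero ∷ [] , 1≤3+d) (closedSum-inner {suc m} f zero [] 1≤3+d 2≤3+d)))
  nz-a : NonzeroMod n a
  nz-a = subst (NonzeroMod n) (cancel a b)
    (reduce (a ℤ.+ b) b
      (at (zero ∷ zero ∷ [] , 2≤3+d) (closedSum-inner {suc m} f zero (zero ∷ []) 2≤3+d 3≤3+d)))
  leaves = replicate (suc (suc d)) zero
  depth-leaves : length leaves ≡ suc (suc d)
  depth-leaves = Listₚ.length-replicate (suc (suc d))
  leaf≤ : suc (length leaves) ≤ suc (suc (suc d))
  leaf≤ = s≤s (ℕₚ.≤-reflexive depth-leaves)
  nz-a+b : NonzeroMod n (a ℤ.+ b)
  nz-a+b = alternate-pairs (λ s t → NonzeroMod n (t ℤ.+ s) → NonzeroMod n (a ℤ.+ b))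
    (subst (NonzeroMod n) (ℤₚ.+-comm b a)) id (suc (suc d))
    (at (zero ∷ leaves , leaf≤) (closedSum-leaf {suc m} f zero leaves leaf≤ depth-leaves))

closedNonzero⇒¬order2 : ∀ {n m d} {ℓ : Labeling (suc m) (suc (suc (suc d)))} →
  1 ≤ n → n ≤ 3 → n ∣ suc m + 1 → Proper ℓ → ClosedNonzeroMod n ℓ → ¬ HasOrder ℓ 2
closedNonzero⇒¬order2 1≤n n≤3 n∣m+1 proper nz order with proper-order2⇒alternating proper order
... | _ , _ , ℓ≗alternate = alternating-¬closedNonzero 1≤n n≤3 n∣m+1 (closedNonzero-cong ℓ≗alternate nz)

ClosedColouring : ℕ → ℕ → ℕ → ℕ → Set
ClosedColouring n m d k = Σ (Labeling m d) λ ℓ → Proper ℓ × ClosedNonzeroMod n ℓ × HasOrder ℓ k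

alternating-colouring : ∀ {n m d} a b → a ≢ b →
  NonzeroMod n (a ℤ.+ + suc m ℤ.* b) →
  NonzeroMod n (b ℤ.+ a ℤ.+ + suc m ℤ.* a) →
  (2 < suc d → NonzeroMod n (a ℤ.+ b ℤ.+ + suc m ℤ.* b)) →
  NonzeroMod n (a ℤ.+ b) →
  ClosedColouring n (suc m) (suc d) 2
alternating-colouring {n} {m} {d} a b a≢b root odd even leaf =
  depthLabeling f ,
  depthLabeling-proper (alternate-pairs _≢_ a≢b (≢-sym a≢b)) ,
  depthLabeling-closedNonzero f root inner
    (alternate-pairs (λ s t → NonzeroMod n (t ℤ.+ s))
      (subst (NonzeroMod n) (ℤₚ.+-comm a b) leaf) leaf d) ,
  depthLabeling-hasOrder f (a ∷ b ∷ []) ((a≢b ∷ []) ∷ [] ∷ [])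
    (alternate-pairs (λ s _ → s ∈ a ∷ b ∷ []) (here refl) (there (here refl))) attained
  where
  f : ℕ → ℤ
  f = alternate a b
  inner : ∀ k → suc k < suc d → NonzeroMod n (f (suc k) ℤ.+ f k ℤ.+ + suc m ℤ.* f (suc (suc k)))
  inner zero _ = odd
  inner (suc zero) 2<1+d = even 2<1+d
  inner (suc (suc k)) 3+k<1+d = inner k (ℕₚ.m+n≤o⇒n≤o 2 3+k<1+d)
  attained : ∀ {x} → x ∈ a ∷ b ∷ [] → ∃ λ k → k ≤ suc d × f k ≡ x
  attained (here refl) = 0 , z≤n , refl
  attained (there (here refl)) = 1 , s≤s z≤n , refl

cyclic-colouring : ∀ {n m d} x y z → x ≢ y → y ≢ z → z ≢ x →
  NonzeroMod n (x ℤ.+ + suc m ℤ.* y) →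
  NonzeroMod n (y ℤ.+ x ℤ.+ + suc m ℤ.* z) →
  NonzeroMod n (z ℤ.+ y ℤ.+ + suc m ℤ.* x) →
  NonzeroMod n (x ℤ.+ z ℤ.+ + suc m ℤ.* y) →
  NonzeroMod n (cycle3 x y z (suc (suc d)) ℤ.+ cycle3 x y z (suc d)) →
  ClosedColouring n (suc m) (suc (suc d)) 3
cyclic-colouring {n} {m} {d} x y z x≢y y≢z z≢x root inner-x inner-y inner-z leaf =
  depthLabeling f ,
  depthLabeling-proper (cycle3-triples (λ s t _ → s ≢ t) x≢y y≢z z≢x) ,
  depthLabeling-closedNonzero f root
    (λ k _ → cycle3-triples (λ s t u → NonzeroMod n (t ℤ.+ s ℤ.+ + suc m ℤ.* u))
      inner-x inner-y inner-z k)
    leaf ,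
  depthLabeling-hasOrder f (x ∷ y ∷ z ∷ []) ((x≢y ∷ ≢-sym z≢x ∷ []) ∷ (y≢z ∷ []) ∷ [] ∷ [])
    (cycle3-triples (λ s _ _ → s ∈ x ∷ y ∷ z ∷ [])
      (here refl) (there (here refl)) (there (there (here refl))))
    attained
  where
  f : ℕ → ℤ
  f = cycle3 x y z
  attained : ∀ {t} → t ∈ x ∷ y ∷ z ∷ [] → ∃ λ k → k ≤ suc (suc d) × f k ≡ t
  attained (here refl) = 0 , z≤n , refl
  attained (there (here refl)) = 1 , s≤s z≤n , refl
  attained (there (there (here refl))) = 2 , s≤s (s≤s z≤n) , refl

twoColouring-n∤m+1 : ∀ {n m d} → 2 ≤ n → ¬ n ∣ suc m + 1 → ClosedColouring n (suc m) (suc d) 2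
twoColouring-n∤m+1 {n} {m} 2≤n n∤m+1 =
  alternating-colouring (+ 1) (+ 0) (λ ())
    (subst (NonzeroMod n) (sym (s+M*0≡s (+ 1) (+ suc m))) one)
    (subst (NonzeroMod n) (sym (0+1+M*1≡M+1 (+ suc m))) n∤m+1)
    (λ _ → subst (NonzeroMod n) (sym (s+M*0≡s (+ 1) (+ suc m))) one)
    one
  where
  one : NonzeroMod n (+ 1)
  one = nonzeroMod-small {s = + 1} (s≤s z≤n) 2≤n
  s+M*0≡s : ∀ s M → s ℤ.+ M ℤ.* + 0 ≡ s
  s+M*0≡s = solve-∀
  0+1+M*1≡M+1 : ∀ M → + 0 ℤ.+ + 1 ℤ.+ M ℤ.* + 1 ≡ M ℤ.+ + 1
  0+1+M*1≡M+1 = solve-∀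

twoColouring-d≡2 : ∀ {n m} → 2 ≤ n → n ∣ suc m + 1 → ClosedColouring n (suc m) 2 2
twoColouring-d≡2 {n} {m} 2≤n n∣m+1 =
  alternating-colouring (+ 0) (+ 1) (λ ())
    (reduce (+ 0) (+ 1) (unit (ℤ.- + 1) refl))
    (reduce (+ 1 ℤ.+ + 0) (+ 0) (unit (+ 1) refl))
    (λ { (s≤s (s≤s ())) })
    (unit (+ 1) refl)
  where
  reduce : ∀ s u → NonzeroMod n (s ℤ.- u) → NonzeroMod n (s ℤ.+ + suc m ℤ.* u)
  reduce = nonzeroMod[s-u]⇒nonzeroMod[s+m*u] n∣m+1
  unit : ∀ s → ℤ.∣ s ∣ ≡ 1 → NonzeroMod n s
  unit s ∣s∣≡1 = nonzeroMod-small {s = s} (ℕₚ.≤-reflexive (sym ∣s∣≡1)) (subst (_< n) (sym ∣s∣≡1) 2≤n)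

twoColouring-4≤n : ∀ {n m d} → 4 ≤ n → n ∣ suc m + 1 → ClosedColouring n (suc m) (suc d) 2
twoColouring-4≤n {n} {m} 4≤n n∣m+1 =
  alternating-colouring (+ 1) (+ 2) (λ ())
    (reduce (+ 1) (+ 2) (small (ℤ.- + 1)))
    (reduce (+ 2 ℤ.+ + 1) (+ 1) (small (+ 2)))
    (λ _ → reduce (+ 1 ℤ.+ + 2) (+ 2) (small (+ 1)))
    (small (+ 3))
  where
  reduce : ∀ s u → NonzeroMod n (s ℤ.- u) → NonzeroMod n (s ℤ.+ + suc m ℤ.* u)
  reduce = nonzeroMod[s-u]⇒nonzeroMod[s+m*u] n∣m+1
  small : ∀ s → {True (0 <? ℤ.∣ s ∣)} → {True (ℤ.∣ s ∣ <? 4)} → NonzeroMod n s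
  small s {0<∣s∣} {∣s∣<4} =
    nonzeroMod-small {s = s} (toWitness 0<∣s∣) (ℕₚ.<-≤-trans (toWitness ∣s∣<4) 4≤n)

-- The closed sums reduce to ±1, ±5 and 7, all prime to 6, except that a leaf pair 6 + 0 or 0 + 6
-- is divisible by 6, so the depth of the leaves modulo 3 decides which of the two patterns to use.
threeColouring-n∣6 : ∀ {n m d} → 2 ≤ n → n ∣ 6 → n ∣ suc m + 1 →
  ClosedColouring n (suc m) (suc (suc (suc d))) 3
threeColouring-n∣6 {n} {m} {d} 2≤n n∣6 n∣m+1 =
  [ cyclic-colouring (+ 1) (+ 0) (+ 6) (λ ()) (λ ()) (λ ())
      (reduce (+ 1) (+ 0) (coprime (+ 1)))
      (reduce (+ 0 ℤ.+ + 1) (+ 6) (coprime (ℤ.- + 5)))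
      (reduce (+ 6 ℤ.+ + 0) (+ 1) (coprime (+ 5)))
      (reduce (+ 1 ℤ.+ + 6) (+ 0) (coprime (+ 7)))
  , cyclic-colouring (+ 0) (+ 1) (+ 6) (λ ()) (λ ()) (λ ())
      (reduce (+ 0) (+ 1) (coprime (ℤ.- + 1)))
      (reduce (+ 1 ℤ.+ + 0) (+ 6) (coprime (ℤ.- + 5)))
      (reduce (+ 6 ℤ.+ + 1) (+ 0) (coprime (+ 7)))
      (reduce (+ 0 ℤ.+ + 6) (+ 1) (coprime (+ 5)))
  ]′ (leaf-pair (suc (suc d)))
  where
  reduce : ∀ s u → NonzeroMod n (s ℤ.- u) → NonzeroMod n (s ℤ.+ + suc m ℤ.* u)
  reduce = nonzeroMod[s-u]⇒nonzeroMod[s+m*u] n∣m+1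
  coprime : ∀ s → {True (coprime? ℤ.∣ s ∣ 6)} → NonzeroMod n s
  coprime s {c} = nonzeroMod-coprime {s = s} 2≤n n∣6 (toWitness c)
  A B : ℕ → ℤ
  A = cycle3 (+ 1) (+ 0) (+ 6)
  B = cycle3 (+ 0) (+ 1) (+ 6)
  leaf-pair : ∀ k → NonzeroMod n (A (suc k) ℤ.+ A k) ⊎ NonzeroMod n (B (suc k) ℤ.+ B k)
  leaf-pair zero = inj₁ (coprime (+ 1))
  leaf-pair (suc zero) = inj₂ (coprime (+ 7))
  leaf-pair (suc (suc zero)) = inj₁ (coprime (+ 7))
  leaf-pair (suc (suc (suc k))) = leaf-pair k

2≤n≤3⇒n∣6 : ∀ {n} → 2 ≤ n → n ≤ 3 → n ∣ 6
2≤n≤3⇒n∣6 {2} _ _ = divides 3 refl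
2≤n≤3⇒n∣6 {3} _ _ = divides 2 refl
2≤n≤3⇒n∣6 {1} (s≤s ()) _
2≤n≤3⇒n∣6 {suc (suc (suc (suc _)))} _ (s≤s (s≤s (s≤s ())))

chi≡2 : ∀ {n m d} → 2 ≤ n → (4 ≤ n ⊎ ¬ (n ∣ suc m + 1) ⊎ suc d ≡ 2) →
  ChiIs n (suc m) (suc d) 2
chi≡2 {n} {m} 2≤n cond = colouring cond (n ∣? suc m + 1) , λ _ _ proper _ → proper⇒2≤order proper
  where
  colouring : ∀ {d} → (4 ≤ n ⊎ ¬ (n ∣ suc m + 1) ⊎ suc d ≡ 2) → Dec (n ∣ suc m + 1) →
    ClosedColouring n (suc m) (suc d) 2
  colouring _ (no n∤m+1) = twoColouring-n∤m+1 2≤n n∤m+1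
  colouring (inj₁ 4≤n) (yes n∣m+1) = twoColouring-4≤n 4≤n n∣m+1
  colouring (inj₂ (inj₁ n∤m+1)) (yes n∣m+1) = contradiction n∣m+1 n∤m+1
  colouring (inj₂ (inj₂ refl)) (yes n∣m+1) = twoColouring-d≡2 2≤n n∣m+1

chi≡3 : ∀ {n m d} → 2 ≤ n → ¬ (4 ≤ n ⊎ ¬ (n ∣ suc m + 1) ⊎ suc (suc d) ≡ 2) →
  ChiIs n (suc m) (suc (suc d)) 3
chi≡3 {d = zero} _ ¬cond = contradiction (inj₂ (inj₂ refl)) ¬cond
chi≡3 {n} {m} {suc d} 2≤n ¬cond =
  threeColouring-n∣6 2≤n (2≤n≤3⇒n∣6 2≤n n≤3) n∣m+1 ,
  λ ℓ j proper nz order → ℕₚ.≤∧≢⇒< (proper⇒2≤order proper order) λ 2≡j →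
    closedNonzero⇒¬order2 (ℕₚ.<⇒≤ 2≤n) n≤3 n∣m+1 proper nz (subst (HasOrder ℓ) (sym 2≡j) order)
  where
  n≤3 : n ≤ 3
  n≤3 = ℕₚ.≤-pred (ℕₚ.≰⇒> (¬cond ∘ inj₁))
  n∣m+1 : n ∣ suc m + 1
  n∣m+1 = decidable-stable (n ∣? suc m + 1) (¬cond ∘ inj₂ ∘ inj₁)

theorem4p7 : ∀ (n m d : ℕ) → 2 ≤ n → 2 ≤ m → 2 ≤ d →
    ((4 ≤ n ⊎ ¬ (n ∣ m + 1) ⊎ d ≡ 2) → ChiIs n m d 2)
    × (¬ (4 ≤ n ⊎ ¬ (n ∣ m + 1) ⊎ d ≡ 2) → ChiIs n m d 3)
theorem4p7 n (suc m) (suc (suc d)) 2≤n _ _ = chi≡2 2≤n , chi≡3 2≤n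
theorem4p7 n (suc m) 1 _ _ (s≤s ())
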